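{- Let $\mathfrak T=(V,E,V_I,\lambda)$ be a transition system over $\mathrm{AP}$ and let $\phi=\forall\pi_0\exists\pi_1\cdots\forall\pi_{k-2}\exists\pi_{k-1}.\,\psi$ be a HyperQPTL sentence ($k\ge 2$ even, $\psi$ trace-quantifier-free). Let $\Xi=(\Xi_i)_{i\in I_\forall}$ with $\Xi_i=\{\xi_{i,1},\dots,\xi_{i,n_i}\}$ be any family of QPTL sentences over $\mathrm{AP}$ such that each $\xi\in\Xi_i$ uses only trace variables $\pi_j$ with $j$ even and $j\le i$, and let $\mathcal P=(P_i)_{i\in I_\forall}$ with $P_i=\{\mathbf p_{i,1},\dots,\mathbf p_{i,n_i}\}$, where $\mathrm{AP}$, the sets $P_i$ and the set $\{\mathbf m_i\mid i\in I_\forall\}$ are pairwise disjoint. If the coalition of Verifier-players has a winning collection of strategies in the game $\mathcal G(\mathfrak T^{\mathcal P},\phi^{\Xi})$, then $\mathfrak T\models\phi$.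
   Context: Notation: for infinite words $w_0,\dots,w_{n-1}$ over $\Sigma$, their merge $\otimes(w_0,\dots,w_{n-1})$ is the infinite word over $\Sigma^n$ whose $j$-th letter is $(w_0(j),\dots,w_{n-1}(j))$. $\mathrm{AP}$ is a finite set of atomic propositions (assumed to contain enough propositions for propositional quantification); a trace over a set $X$ is an infinite word over $2^X$. $I_\forall=\{0,2,\dots,k-2\}$, $I_\exists=\{1,3,\dots,k-1\}$. Transition systems: $\mathfrak T=(V,E,V_I,\lambda)$ with finite $V$, $E\subseteq V\times V$ such that every vertex has a successor, nonempty $V_I\subseteq V$, $\lambda:V\to 2^{\mathrm{AP}}$. $\mathrm{Succ}(v)=\{v'\mid (v,v')\in E\}$. A path is an infinite sequence $v_0v_1\cdots$ with $v_0\in V_I$ and $(v_n,v_{n+1})\in E$; its trace is $\lambda(v_0)\lambda(v_1)\cdots$; $\mathrm{traces}(\mathfrak T)$ is the set of traces of paths. HyperQPTL: formulas $\phi::=\exists\pi.\phi\mid\forall\pi.\phi\mid\psi$ and $\psi::=\tilde\exists\mathbf q.\psi\mid\tilde\forall\mathbf q.\psi\mid\mathbf p_\pi\mid\mathbf q\mid\neg\psi\mid\psi\vee\psi\mid\mathbf X\psi\mid\psi\,\mathbf U\,\psi$, with $\mathbf p,\mathbf q\in\mathrm{AP}$ and $\pi$ a trace variable. For a nonempty set $T$ of traces, a partial map $\Pi$ from trace variables to traces, and $i\in\mathbb N$: $T,\Pi,i\models\mathbf p_\pi$ iff $\mathbf p\in\Pi(\pi)(i)$; $T,\Pi,i\models\mathbf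 q$ iff $\mathbf q\in t(i)$ for all $t\in T$; $\neg,\vee$ as usual; $\mathbf X\psi$ iff $T,\Pi,i+1\models\psi$; $\psi_1\mathbf U\psi_2$ iff some $j\ge i$ has $T,\Pi,j\models\psi_2$ and $T,\Pi,j'\models\psi_1$ for all $i\le j'<j$; $\tilde\exists\mathbf q.\psi$ (resp. $\tilde\forall\mathbf q.\psi$) iff for some (resp. all) traces $t_{\mathbf q}$ over $\{\mathbf q\}$, $T[\mathbf q\mapsto t_{\mathbf q}],\Pi,i\models\psi$, where $T[\mathbf q\mapsto t_{\mathbf q}]$ is obtained by replacing in every trace of $T$ the occurrences of $\mathbf q$ according to $t_{\mathbf q}$; $\exists\pi.\phi$ (resp. $\forall\pi.\phi$) iff for some (resp. all) $t\in T$, $T,\Pi[\pi\mapsto t],i\models\phi$. $\mathfrak T\models\phi$ iff $\mathrm{traces}(\mathfrak T),\Pi_\emptyset,0\models\phi$ ($\Pi_\emptyset$ the empty assignment). For a trace-quantifier-free formula without free unlabeled propositions, satisfaction does not depend on $T$; write $\Pi,i\models\psi$. A QPTL sentence is such a formula (trace-quantifier-free, every unlabeled proposition bound by a propositional quantifier), possibly with free trace variables. Deterministic parity automaton $(Q,\Sigma,q_I,\delta,\Omega)$: $\delta:Q\times\Sigma\to Q$, $\Omega:Q\to\mathbb N$; a word is accepted iff the maximal color occurring infinitely often on its run is even. System manipulation $\mathfrak T^{\mathcal P}$: for $i\in I_\forall$, $\mathfrak T^{P_i}$ has vertices $V\times 2^{P_i}\times\{i\}$, edges $((s,A,i),(s',A',i))$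 for all $(s,s')\in E$ and $A,A'\subseteq P_i$, initial vertices $V_I\times 2^{P_i}\times\{i\}$, and labeling $(s,A,i)\mapsto\lambda(s)\cup A\cup\{\mathbf m_i\}$. $\mathfrak T^{\mathcal P}$ is the disjoint union of the $\mathfrak T^{P_i}$, $i\in I_\forall$ (initial vertices: union of their initial vertices), a transition system over $\mathrm{AP}\cup\bigcup_iP_i\cup\{\mathbf m_i\mid i\in I_\forall\}$. Property manipulation: $\phi^\Xi=\forall\pi_0\exists\pi_1\cdots\forall\pi_{k-2}\exists\pi_{k-1}.\Big[\bigwedge_{i\in I_\forall}\big((\mathbf m_i)_{\pi_i}\wedge\mathbf G\bigwedge_{\ell=1}^{n_i}((\mathbf p_{i,\ell})_{\pi_i}\leftrightarrow\xi_{i,\ell})\big)\Big]\rightarrow\psi$. The game $\mathcal G(\mathfrak T',\phi')$ for a transition system $\mathfrak T'=(V',E',V_I',\lambda')$ over $\mathrm{AP}'$ and a sentence $\phi'=\forall\pi_0\exists\pi_1\cdots\forall\pi_{k-2}\exists\pi_{k-1}.\psi'$ with trace-quantifier-free $\psi'$: let $\mathcal B=(Q,(2^{\mathrm{AP}'})^k,q_I,\delta,\Omega)$ be a deterministic parity automaton accepting exactly the words $\otimes(t_0,\dots,t_{k-1})$ with all $t_j\in\mathrm{traces}(\mathfrak T')$ and $\Pi_\emptyset[\pi_0\mapsto t_0,\dots,\pi_{k-1}\mapsto t_{k-1}],0\models\psi'$. Players are Falsifier and a coalition of Verifier-players indexed by $I_\exists$. Positions are $((x_0,\dots,x_{k-1}),q,i)$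 with $i\in\{0,\dots,k-1\}$, $q\in Q$, and either (initialization phase) $q=q_I$, $x_0,\dots,x_{i-1}\in V'_I$ and $x_i=\dots=x_{k-1}=\bullet$ (a fresh symbol), or all $x_j\in V'$. Positions with odd last component $i$ belong to Verifier-player $i$, those with even $i$ to Falsifier. The initial position is $((\bullet,\dots,\bullet),q_I,0)$. At $((x_0,\dots,x_{k-1}),q,i)$ the owner picks $x_i'\in V_I'$ if $x_i=\bullet$ and $x_i'\in\mathrm{Succ}(x_i)$ otherwise, and $x_i$ is replaced by $x_i'$; if $i<k-1$ the new position has state $q$ and last component $i+1$; if $i=k-1$ the new position is $((x_0,\dots,x_{k-2},x_{k-1}'),\delta(q,(\lambda'(x_0),\dots,\lambda'(x_{k-2}),\lambda'(x'_{k-1}))),0)$. Initialization positions have color $0$, other positions have color $\Omega(q)$; a play is won by the coalition iff the maximal color seen infinitely often is even. Imperfect information: for Verifier-player $i$, positions $((x_0,\dots,x_{k-1}),q,m)$ and $((y_0,\dots,y_{k-1}),q',n)$ are indistinguishable iff $x_j=y_j$ for all $j\le i$ and $m=n$; a strategy for Verifier-player $i$ chooses her move as a function of the sequence of indistinguishability classes of the positions visited so far (excluding the initial one). A collection of strategies (one per Verifier-player) is winning if every play consistent with all of them is won by the coalition. -}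

module Defs where

open import Data.Nat using (ℕ; zero; suc; _≤_; _<_; _<?_; _≤ᵇ_; _≡ᵇ_; _*_; _+_; _%_)
open import Data.Fin using (Fin; toℕ; fromℕ<) renaming (zero to fzero; suc to fsuc)
import Data.Fin.Properties as FinP
open import Data.Bool using (Bool; true; false; if_then_else_; _∧_)
open import Data.Maybe using (Maybe; just; nothing)
open import Data.Product using (Σ; _×_; _,_; proj₁; proj₂)
open import Data.Sum using (_⊎_; inj₁; inj₂)
import Data.Sum.Properties as SumP
import Data.Product.Properties as ProdP
open import Data.List using (List; []; _∷_; _++_; map; allFin)
open import Data.List.Membership.Propositional using (_∈_)
open import Data.Vec using (Vec; lookup; replicate; _[_]≔_; tabulate)
import Data.Vec as Vec
open import Data.Unit using (⊤)
open import Data.Empty using (⊥)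
open import Relation.Nullary using (¬_; yes; no; Dec)
open import Relation.Nullary.Decidable using (⌊_⌋)
open import Relation.Binary.PropositionalEquality using (_≡_; refl)
open import Relation.Binary.Definitions using (DecidableEquality)
open import Function.Bundles using (_⇔_)

Letter : Set → Set
Letter X = X → Bool

Trace : Set → Set
Trace X = ℕ → Letter X

-- HyperQPTL syntax.  Trace variables are natural numbers (π_j ↦ j).
-- QF X : trace-quantifier-free formulas (ψ), HF X : formulas (φ).

infixl 5 _∨f_
infixl 6 _Uf_

data QF (X : Set) : Set where
  ∃q   : X → QF X → QF X
  ∀q   : X → QF X → QF X
  lab  : X → ℕ → QF X
  unl  : X → QF X
  ¬f   : QF X → QF X
  _∨f_ : QF X → QF X → QF X
  Xf   : QF X → QF X
  _Uf_ : QF X → QF X → QF X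

data HF (X : Set) : Set where
  ∃π : ℕ → HF X → HF X
  ∀π : ℕ → HF X → HF X
  qf : QF X → HF X

mapQF : {X Y : Set} → (X → Y) → QF X → QF Y
mapQF f (∃q q ψ) = ∃q (f q) (mapQF f ψ)
mapQF f (∀q q ψ) = ∀q (f q) (mapQF f ψ)
mapQF f (lab p π) = lab (f p) π
mapQF f (unl q) = unl (f q)
mapQF f (¬f ψ) = ¬f (mapQF f ψ)
mapQF f (ψ ∨f ψ₁) = mapQF f ψ ∨f mapQF f ψ₁
mapQF f (Xf ψ) = Xf (mapQF f ψ)
mapQF f (ψ Uf ψ₁) = mapQF f ψ Uf mapQF f ψ₁

_∧f_ : {X : Set} → QF X → QF X → QF X
a ∧f b = ¬f (¬f a ∨f ¬f b)

_⇒f_ : {X : Set} → QF X → QF X → QF X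
a ⇒f b = ¬f a ∨f b

_⇔f_ : {X : Set} → QF X → QF X → QF X
a ⇔f b = (a ⇒f b) ∧f (b ⇒f a)

-- G a  :=  ¬ (true U ¬a), with true expressed as (a ∨ ¬a)
Gf : {X : Set} → QF X → QF X
Gf a = ¬f ((a ∨f ¬f a) Uf ¬f a)

-- conjunction of a list; the first argument is the value for the empty list
-- (always instantiated with a tautology below)
andAll : {X : Set} → QF X → List (QF X) → QF X
andAll b [] = b
andAll b (x ∷ xs) = x ∧f andAll b xs

alt : {X : Set} → ℕ → ℕ → QF X → HF X
alt zero off ψ = qf ψ
alt (suc h) off ψ = ∀π off (∃π (suc off) (alt h (suc (suc off)) ψ))

ClosedUnder : {X : Set} → List X → QF X → Set
ClosedUnder bs (∃q q ψ) = ClosedUnder (q ∷ bs) ψ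
ClosedUnder bs (∀q q ψ) = ClosedUnder (q ∷ bs) ψ
ClosedUnder bs (lab p π) = ⊤
ClosedUnder bs (unl q) = q ∈ bs
ClosedUnder bs (¬f ψ) = ClosedUnder bs ψ
ClosedUnder bs (ψ ∨f ψ₁) = ClosedUnder bs ψ × ClosedUnder bs ψ₁
ClosedUnder bs (Xf ψ) = ClosedUnder bs ψ
ClosedUnder bs (ψ Uf ψ₁) = ClosedUnder bs ψ × ClosedUnder bs ψ₁

Closed : {X : Set} → QF X → Set
Closed = ClosedUnder []

TraceVarsIn : {X : Set} → (ℕ → Set) → QF X → Set
TraceVarsIn P (∃q q ψ) = TraceVarsIn P ψ
TraceVarsIn P (∀q q ψ) = TraceVarsIn P ψ
TraceVarsIn P (lab p π) = P π
TraceVarsIn P (unl q) = ⊤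
TraceVarsIn P (¬f ψ) = TraceVarsIn P ψ
TraceVarsIn P (ψ ∨f ψ₁) = TraceVarsIn P ψ × TraceVarsIn P ψ₁
TraceVarsIn P (Xf ψ) = TraceVarsIn P ψ
TraceVarsIn P (ψ Uf ψ₁) = TraceVarsIn P ψ × TraceVarsIn P ψ₁

TraceSet : Set → Set₁
TraceSet X = Trace X → Set

Assign : Set → Set
Assign X = ℕ → Maybe (Trace X)

_[_↦_] : {X : Set} → Assign X → ℕ → Trace X → Assign X
(Π [ π ↦ t ]) π' = if π' ≡ᵇ π then just t else Π π'

updTrace : {X : Set} → DecidableEquality X → X → (ℕ → Bool) → Trace X → Trace X
updTrace eq q tq t j x = if ⌊ eq x q ⌋ then tq j else t j x

replaceSet : {X : Set} → DecidableEquality X → X → (ℕ → Bool) → TraceSet X → TraceSet X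
replaceSet eq q tq T t' =
  Σ (Trace _) λ t → T t × (∀ j x → t' j x ≡ updTrace eq q tq t j x)

labHolds : {X : Set} → Maybe (Trace X) → ℕ → X → Set
labHolds nothing i p = ⊥
labHolds (just t) i p = t i p ≡ true

sat : {X : Set} → DecidableEquality X → TraceSet X → Assign X → ℕ → QF X → Set
sat eq T Π i (∃q q ψ) = Σ (ℕ → Bool) λ tq → sat eq (replaceSet eq q tq T) Π i ψ
sat eq T Π i (∀q q ψ) = (tq : ℕ → Bool) → sat eq (replaceSet eq q tq T) Π i ψ
sat eq T Π i (lab p π) = labHolds (Π π) i p
sat eq T Π i (unl q) = ∀ t → T t → t i q ≡ true
sat eq T Π i (¬f ψ) = ¬ sat eq T Π i ψ
sat eq T Π i (ψ ∨f ψ₁) = sat eq T Π i ψ ⊎ sat eq T Π i ψ₁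
sat eq T Π i (Xf ψ) = sat eq T Π (suc i) ψ
sat eq T Π i (ψ Uf ψ₁) =
  Σ ℕ λ j → i ≤ j × sat eq T Π j ψ₁ × (∀ j' → i ≤ j' → j' < j → sat eq T Π j' ψ)

satH : {X : Set} → DecidableEquality X → TraceSet X → Assign X → ℕ → HF X → Set
satH eq T Π i (∃π π φ) = Σ (Trace _) λ t → T t × satH eq T (Π [ π ↦ t ]) i φ
satH eq T Π i (∀π π φ) = (t : Trace _) → T t → satH eq T (Π [ π ↦ t ]) i φ
satH eq T Π i (qf ψ) = sat eq T Π i ψ

Π∅ : {X : Set} → Assign X
Π∅ _ = nothing

record TS (X V : Set) : Set₁ where
  field
    E     : V → V → Set
    total : ∀ v → Σ V (E v)
    VI    : V → Set
    VIne  : Σ V VI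
    λl    : V → Letter X

module _ {X V : Set} (T : TS X V) where
  open TS T

  IsPath : (ℕ → V) → Set
  IsPath p = VI (p 0) × (∀ n → E (p n) (p (suc n)))

  traces : TraceSet X
  traces t = Σ (ℕ → V) λ p → IsPath p × (∀ j x → t j x ≡ λl (p j) x)

_⊨[_]_ : {X V : Set} → TS X V → DecidableEquality X → HF X → Set
T ⊨[ eq ] φ = satH eq (traces T) Π∅ 0 φ

-- I∀ = {0,2,…,k-2} is indexed by i : Fin (suc h')
-- (standing for 2i), k = 2·(suc h').  P_i = {p_{i,ℓ} | ℓ : Fin (n i)}.
-- AP' = AP ⊎ (⋃ P_i) ⊎ {m_i}  (disjointness is built in).

AP' : ℕ → (h' : ℕ) → (Fin (suc h') → ℕ) → Set
AP' a h' n = Fin a ⊎ (Σ (Fin (suc h')) (λ i → Fin (n i)) ⊎ Fin (suc h'))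

decAP' : (a h' : ℕ) (n : Fin (suc h') → ℕ) → DecidableEquality (AP' a h' n)
decAP' a h' n = SumP.≡-dec FinP._≟_ (SumP.≡-dec (ProdP.≡-dec FinP._≟_ FinP._≟_) FinP._≟_)

pProp : {a h' : ℕ} {n : Fin (suc h') → ℕ} → (i : Fin (suc h')) → Fin (n i) → AP' a h' n
pProp i ℓ = inj₂ (inj₁ (i , ℓ))

mProp : {a h' : ℕ} {n : Fin (suc h') → ℕ} → Fin (suc h') → AP' a h' n
mProp i = inj₂ (inj₂ i)

VP : Set → (h' : ℕ) → (Fin (suc h') → ℕ) → Set
VP V h' n = Σ (Fin (suc h')) λ i → V × (Fin (n i) → Bool)

labP : {h' : ℕ} {n : Fin (suc h') → ℕ} (i : Fin (suc h')) → (Fin (n i) → Bool) →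
       (j : Fin (suc h')) → Fin (n j) → Bool
labP i A j ℓ with j FinP.≟ i
... | yes refl = A ℓ
... | no _ = false

manip : {a nV h' : ℕ} (n : Fin (suc h') → ℕ) → TS (Fin a) (Fin nV) →
        TS (AP' a h' n) (VP (Fin nV) h' n)
manip {a} {nV} {h'} n T = record
  { E = λ { (i , s , A) (i' , s' , A') → (i ≡ i') × E s s' }
  ; total = λ { (i , s , A) → (i , proj₁ (total s) , A) , refl , proj₂ (total s) }
  ; VI = λ { (i , s , A) → VI s }
  ; VIne = (fzero , proj₁ VIne , (λ _ → false)) , proj₂ VIne
  ; λl = lbl
  }
  where
  open TS T
  lbl : VP (Fin nV) h' n → Letter (AP' a h' n)
  lbl (i , s , A) (inj₁ x) = λl s x
  lbl (i , s , A) (inj₂ (inj₁ (j , ℓ))) = labP i A j ℓ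
  lbl (i , s , A) (inj₂ (inj₂ j)) = ⌊ j FinP.≟ i ⌋

-- Property manipulation: the matrix ψ^Ξ of φ^Ξ = alt (suc h') 0 ψ^Ξ

module _ {a h' : ℕ} {n : Fin (suc h') → ℕ} where
  embed : QF (Fin a) → QF (AP' a h' n)
  embed = mapQF inj₁

  πU : Fin (suc h') → ℕ
  πU i = 2 * toℕ i

  tautU : Fin (suc h') → QF (AP' a h' n)
  tautU i = lab (mProp i) (πU i) ∨f ¬f (lab (mProp i) (πU i))

  conjunctU : ((i : Fin (suc h')) → Fin (n i) → QF (Fin a)) → Fin (suc h') → QF (AP' a h' n)
  conjunctU ξ i =
    lab (mProp i) (πU i) ∧f
      Gf (andAll (tautU i)
           (map (λ ℓ → lab (pProp i ℓ) (πU i) ⇔f embed (ξ i ℓ)) (allFin (n i))))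

  ψΞ : QF (Fin a) → ((i : Fin (suc h')) → Fin (n i) → QF (Fin a)) → QF (AP' a h' n)
  ψΞ ψ ξ = andAll (tautU fzero) (map (conjunctU ξ) (allFin (suc h'))) ⇒f embed ψ

ParityWin : (ℕ → ℕ) → Set
ParityWin c = Σ ℕ λ m → (m % 2 ≡ 0)
                      × (∀ N → Σ ℕ λ j → N ≤ j × c j ≡ m)
                      × (Σ ℕ λ N → ∀ j → N ≤ j → c j ≤ m)

record DPA (Σa : Set) : Set where
  field
    nQ : ℕ
    qI : Fin nQ
    δ  : Fin nQ → Σa → Fin nQ
    Ω  : Fin nQ → ℕ

module _ {Σa : Set} (B : DPA Σa) where
  open DPA B
  run : (ℕ → Σa) → ℕ → Fin nQ
  run w zero = qI
  run w (suc j) = δ (run w j) (w j)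

  Accepts : (ℕ → Σa) → Set
  Accepts w = ParityWin (λ j → Ω (run w j))

module Game {X V : Set} (eq : DecidableEquality X) (T' : TS X V) {k' : ℕ}
            (B : DPA (Vec (Letter X) (suc k'))) where
  open TS T'
  open DPA B

  K : ℕ
  K = suc k'

  comp : (ℕ → Vec (Letter X) K) → Fin K → Trace X
  comp w j i = lookup (w i) j

  assignW : (ℕ → Vec (Letter X) K) → Assign X
  assignW w π with π <? K
  ... | yes lt = just (comp w (fromℕ< lt))
  ... | no _ = nothing

  Spec : QF X → Set
  Spec ψ' = ∀ (w : ℕ → Vec (Letter X) K) →
    Accepts B w ⇔ ((∀ j → traces T' (comp w j)) × sat eq (traces T') (assignW w) 0 ψ')

  -- positions ((x₀,…,x_{k-1}), q, i);  nothing = •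
  record Pos : Set where
    constructor pos
    field
      xs  : Vec (Maybe V) K
      q   : Fin nQ
      idx : Fin K
  open Pos

  initPos : Pos
  initPos = pos (replicate K nothing) qI fzero

  LegalAt : Maybe V → V → Set
  LegalAt nothing v = VI v
  LegalAt (just x) v = E x v

  Legal : Pos → V → Set
  Legal p v = LegalAt (lookup (xs p) (idx p)) v

  -- labels of the vertices (• never occurs at this point in a reachable position)
  letterOf : Maybe V → Letter X
  letterOf nothing = λ _ → false
  letterOf (just x) = λl x

  stepAux : Vec (Maybe V) K → Fin nQ → Fin K → Pos
  stepAux xs' q₀ i with suc (toℕ i) <? K
  ... | yes lt = pos xs' q₀ (fromℕ< lt)
  ... | no _ = pos xs' (δ q₀ (Vec.map letterOf xs')) fzero

  step : Pos → V → Pos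
  step p v = stepAux (xs p [ idx p ]≔ just v) (q p) (idx p)

  allJust : {m : ℕ} → Vec (Maybe V) m → Bool
  allJust Vec.[] = true
  allJust (just _ Vec.∷ ys) = allJust ys
  allJust (nothing Vec.∷ ys) = false

  colour : Pos → ℕ
  colour p = if allJust (xs p) then Ω (q p) else 0

  -- indistinguishability class of a position for player i: (x₀,…,x_i) and the index
  Obs : Set
  Obs = Vec (Maybe V) K × Fin K

  obs : Fin K → Pos → Obs
  obs i p = tabulate (λ j → if toℕ j ≤ᵇ toℕ i then lookup (xs p) j else nothing) , idx p

  IsVerifier : Fin K → Set
  IsVerifier i = toℕ i % 2 ≡ 1

  -- strategy of Verifier-player i: from the classes of the previously visited
  -- positions (excluding the initial one) and of the current position
  -- (owned by i) to a legal move
  Strategy : Fin K → Set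
  Strategy i = (past : List Obs) (cur : Obs) → proj₂ cur ≡ i →
               Σ V (LegalAt (lookup (proj₁ cur) i))

  Strategies : Set
  Strategies = (i : Fin K) → IsVerifier i → Strategy i

  -- plays are determined by the sequence of moves
  posAt : (ℕ → V) → ℕ → Pos
  posAt μ zero = initPos
  posAt μ (suc j) = step (posAt μ j) (μ j)

  -- classes of positions 1,…,j-1
  past : Fin K → (ℕ → V) → ℕ → List Obs
  past i μ zero = []
  past i μ (suc zero) = []
  past i μ (suc (suc j)) = past i μ (suc j) ++ (obs i (posAt μ (suc j)) ∷ [])

  Consistent : Strategies → (ℕ → V) → Set
  Consistent σ μ = ∀ j → Legal (posAt μ j) (μ j) ×
    (∀ i (vi : IsVerifier i) (e : idx (posAt μ j) ≡ i) →
       μ j ≡ proj₁ (σ i vi (past i μ j) (obs i (posAt μ j)) e))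

  Winning : Strategies → Set
  Winning σ = ∀ μ → Consistent σ μ → ParityWin (λ j → colour (posAt μ j))

  CoalitionWins : Set
  CoalitionWins = Σ Strategies Winning

{-# OPTIONS --safe #-}
-- Fix winning strategies σ of the Verifier coalition. A choice of paths of 𝔗 for π₀, π₂, …, π_{k-2}
-- yields a Falsifier strategy: on component 2i play the path chosen for π_{2i} inside copy i of 𝔗^𝒫,
-- labelling p_{i,ℓ} with the truth value of ξ_{i,ℓ} (decided by excluded middle). Against σ the play
-- is won, so its merged trace is accepted by the automaton and satisfies ψ^Ξ. The Falsifier's labels
-- make the premise of ψ^Ξ true, hence ψ holds, and as 𝔗^𝒫 agrees with 𝔗 on AP, ψ holds for the traces
-- of 𝔗 read off the play. The trace on component 2i+1 is the witness for π_{2i+1}. It depends only on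
-- the paths chosen for π₀, …, π_{2i}: Verifier-player 2i+1 only observes components ≤ 2i+1, and the
-- Falsifier's moves there only involve those paths, because ξ_{j,ℓ} with j ≤ i mentions no other
-- trace variable. So the witnesses respect the quantifier alternation of φ.
module Submission where

open import Defs
open import Level using (0ℓ)
open import Axiom.ExcludedMiddle using (ExcludedMiddle)
open import Data.Bool using (Bool; true; false; if_then_else_)
open import Data.Bool.Properties using (T-≡)
open import Data.Empty using (⊥-elim)
open import Data.Fin using (Fin; toℕ; fromℕ<) renaming (zero to fzero; suc to fsuc)
import Data.Fin.Properties as FinP
open import Data.List using (List; []; _∷_; _++_; map; allFin)
open import Data.List.Membership.Propositional using (_∈_)
open import Data.List.Relation.Unary.Any using (here; there)
open import Data.Maybe using (Maybe; just; nothing)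
open import Data.Maybe.Relation.Binary.Pointwise using (Pointwise; just; nothing)
open import Data.Nat using (ℕ; zero; suc; _<_; _<?_; _≤_; _≤ᵇ_; z<s; _*_; _+_; ⌊_/2⌋; z≤n; s≤s)
open import Data.Nat.Properties
open import Data.Nat.DivMod
  using (_mod_; _/_; _%_; [m+kn]%n≡m%n; m<n⇒m%n≡m; +-distrib-/; m<n⇒m/n≡0; m*n/n≡m; m*n%n≡0; m≡m%n+[m/n]*n)
open import Data.Nat.Induction using (<-wellFounded)
open import Induction.WellFounded using (WfRec; module All; module FixPoint)
open import Data.Product using (Σ; _×_; _,_; proj₁; proj₂)
open import Data.Product.Function.NonDependent.Propositional using (_×-⇔_)
open import Data.Sum using (_⊎_; inj₁; inj₂)
import Data.Sum as Sum
open import Data.Sum.Properties using (inj₁-injective)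
open import Data.Sum.Function.Propositional using (_⊎-⇔_)
open import Data.Vec.Functional using (Vector; updateAt)
open import Data.Vec.Functional.Properties using (updateAt-updates; updateAt-minimal)
open import Data.Vec using (Vec; lookup; _[_]≔_; tabulate)
import Data.Vec as Vec
import Data.Vec.Properties as VecP
open import Function.Base using (_∘_; const; id)
open import Function.Bundles using (_⇔_; mk⇔; Equivalence)
open import Function.Definitions using (Injective)
open import Function.Related.Propositional using (module EquationalReasoning; equivalence)
open import Function.Related.TypeIsomorphisms using (¬-cong-⇔)
import Function.Properties.Equivalence as ⇔
open import Relation.Nullary using (¬_; yes; no; Dec)
open import Relation.Nullary.Decidable using (⌊_⌋; dec-true; dec-false)
open import Relation.Binary.PropositionalEquality
open import Relation.Binary.Definitions using (DecidableEquality)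

isYes-true : {A : Set} (a? : Dec A) → A → ⌊ a? ⌋ ≡ true
isYes-true (yes _) _ = refl
isYes-true (no ¬a) a = ⊥-elim (¬a a)

isYes-false : {A : Set} (a? : Dec A) → ¬ A → ⌊ a? ⌋ ≡ false
isYes-false (yes a) ¬a = ⊥-elim (¬a a)
isYes-false (no _) _ = refl

isYes-true⇔ : {A : Set} (a? : Dec A) → (⌊ a? ⌋ ≡ true) ⇔ A
isYes-true⇔ (yes a) = mk⇔ (λ _ → a) (λ _ → refl)
isYes-true⇔ (no ¬a) = mk⇔ (λ ()) (λ a → ⊥-elim (¬a a))

isYes-cong : {A B : Set} (a? : Dec A) (b? : Dec B) → A ⇔ B → ⌊ a? ⌋ ≡ ⌊ b? ⌋
isYes-cong a? (yes b) A⇔B = isYes-true a? (Equivalence.from A⇔B b)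
isYes-cong a? (no ¬b) A⇔B = isYes-false a? (¬b ∘ Equivalence.to A⇔B)

Σ-cong-⇔ : {I : Set} {A B : I → Set} → (∀ i → A i ⇔ B i) → Σ I A ⇔ Σ I B
Σ-cong-⇔ A⇔B = mk⇔ (λ (i , a) → i , Equivalence.to (A⇔B i) a)
                   (λ (i , b) → i , Equivalence.from (A⇔B i) b)

Π-cong-⇔ : {I : Set} {A B : I → Set} → (∀ i → A i ⇔ B i) → ((i : I) → A i) ⇔ ((i : I) → B i)
Π-cong-⇔ A⇔B = mk⇔ (λ f i → Equivalence.to (A⇔B i) (f i)) (λ g i → Equivalence.from (A⇔B i) (g i))

[↦]-hit : {X : Set} (Π : Assign X) (π : ℕ) (t : Trace X) → (Π [ π ↦ t ]) π ≡ just t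
[↦]-hit Π π t rewrite dec-true (π ≟ π) refl = refl

[↦]-miss : {X : Set} (Π : Assign X) (π : ℕ) (t : Trace X) {π′ : ℕ} → π′ ≢ π →
           (Π [ π ↦ t ]) π′ ≡ Π π′
[↦]-miss Π π t {π′} π′≢π rewrite dec-false (π′ ≟ π) π′≢π = refl

⌊2n/2⌋≡n : ∀ n → ⌊ 2 * n /2⌋ ≡ n
⌊2n/2⌋≡n n = sym (trans (n≡⌊n+n/2⌋ n) (cong (λ m → ⌊ n + m /2⌋) (sym (+-identityʳ n))))

⌊1+2n/2⌋≡n : ∀ n → ⌊ suc (2 * n) /2⌋ ≡ n
⌊1+2n/2⌋≡n zero = refl
⌊1+2n/2⌋≡n (suc n) = trans (cong (λ m → ⌊ suc m /2⌋) (*-suc 2 n)) (cong suc (⌊1+2n/2⌋≡n n))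

n≡2⌊n/2⌋⊎n≡1+2⌊n/2⌋ : ∀ n → n ≡ 2 * ⌊ n /2⌋ ⊎ n ≡ suc (2 * ⌊ n /2⌋)
n≡2⌊n/2⌋⊎n≡1+2⌊n/2⌋ zero = inj₁ refl
n≡2⌊n/2⌋⊎n≡1+2⌊n/2⌋ (suc zero) = inj₂ refl
n≡2⌊n/2⌋⊎n≡1+2⌊n/2⌋ (suc (suc n)) rewrite *-suc 2 ⌊ n /2⌋ with n≡2⌊n/2⌋⊎n≡1+2⌊n/2⌋ n
... | inj₁ e = inj₁ (cong (suc ∘ suc) e)
... | inj₂ e = inj₂ (cong (suc ∘ suc) e)

n≤1+2m⇒⌊n/2⌋≤m : ∀ {n m} → n ≤ suc (2 * m) → ⌊ n /2⌋ ≤ m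
n≤1+2m⇒⌊n/2⌋≤m {m = m} n≤ = subst (_ ≤_) (⌊1+2n/2⌋≡n m) (⌊n/2⌋-mono n≤)

n<2m⇒⌊n/2⌋<m : ∀ {n m} → n < 2 * m → ⌊ n /2⌋ < m
n<2m⇒⌊n/2⌋<m n< = n≤1+2m⇒⌊n/2⌋≤m (s≤s n<)

m<n⇒2m<2n : ∀ {n m} → n < m → 2 * n < 2 * m
m<n⇒2m<2n = *-monoʳ-< 2

m<n⇒1+2m<2n : ∀ {n m} → n < m → suc (2 * n) < 2 * m
m<n⇒1+2m<2n {n} {m} n<m = subst (_≤ 2 * m) (*-suc 2 n) (*-monoʳ-≤ 2 n<m)

mapQF-id : {X : Set} (ψ : QF X) → mapQF id ψ ≡ ψ
mapQF-id (∃q q ψ) = cong (∃q q) (mapQF-id ψ)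
mapQF-id (∀q q ψ) = cong (∀q q) (mapQF-id ψ)
mapQF-id (lab p π) = refl
mapQF-id (unl q) = refl
mapQF-id (¬f ψ) = cong ¬f (mapQF-id ψ)
mapQF-id (ψ ∨f ψ₁) = cong₂ _∨f_ (mapQF-id ψ) (mapQF-id ψ₁)
mapQF-id (Xf ψ) = cong Xf (mapQF-id ψ)
mapQF-id (ψ Uf ψ₁) = cong₂ _Uf_ (mapQF-id ψ) (mapQF-id ψ₁)

module _ {Z : Set} (eq : DecidableEquality Z) where

  updTrace-same : ∀ q tq (t : Trace Z) i → updTrace eq q tq t i q ≡ tq i
  updTrace-same q tq t i rewrite isYes-true (eq q q) refl = refl

  updTrace-other : ∀ q tq (t : Trace Z) i {x} → x ≢ q → updTrace eq q tq t i x ≡ t i x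
  updTrace-other q tq t i {x} x≢q rewrite isYes-false (eq x q) x≢q = refl

  Uniform : TraceSet Z → Z → (ℕ → Bool) → Set
  Uniform T x c = ∀ t → T t → ∀ i → t i x ≡ c i

  replaceSet-uniform : ∀ {T} q tq → Uniform (replaceSet eq q tq T) q tq
  replaceSet-uniform q tq t′ (t , _ , t′≡) i = trans (t′≡ i q) (updTrace-same q tq t i)

  replaceSet-preserves-uniform : ∀ {T x c} q tq → x ≢ q → Uniform T x c → Uniform (replaceSet eq q tq T) x c
  replaceSet-preserves-uniform q tq x≢q unif t′ (t , Tt , t′≡) i =
    trans (t′≡ i _) (trans (updTrace-other q tq t i x≢q) (unif t Tt i))

  uniform-sat-unl : ∀ {T x c} → Σ (Trace Z) T → Uniform T x c →
                    ∀ i → (∀ t → T t → t i x ≡ true) ⇔ (c i ≡ true)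
  uniform-sat-unl (t₀ , Tt₀) unif i =
    mk⇔ (λ all → trans (sym (unif t₀ Tt₀ i)) (all t₀ Tt₀)) (λ ci t Tt → trans (unif t Tt i) ci)

module Renaming {X Y : Set} (eqX : DecidableEquality X) (eqY : DecidableEquality Y)
                (f : X → Y) (f-injective : Injective _≡_ _≡_ f) where

  _≈_ : Trace X → Trace Y → Set
  t ≈ u = ∀ i x → u i (f x) ≡ t i x

  -- What the clause for an unlabelled proposition needs: both trace sets are nonempty and every
  -- proposition bound so far has one valuation shared by all traces of T₁ and T₂.
  record Compatible (bs : List X) (T₁ : TraceSet X) (T₂ : TraceSet Y) : Set where
    field
      inhabited₁ : Σ (Trace X) T₁
      inhabited₂ : Σ (Trace Y) T₂
      bound-uniform : ∀ q → q ∈ bs →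
                      Σ (ℕ → Bool) λ c → Uniform eqX T₁ q c × Uniform eqY T₂ (f q) c

  compatible-[] : ∀ {T₁ T₂} → Σ (Trace X) T₁ → Σ (Trace Y) T₂ → Compatible [] T₁ T₂
  compatible-[] t₁ t₂ = record { inhabited₁ = t₁ ; inhabited₂ = t₂ ; bound-uniform = λ _ () }

  replaceSet-compatible : ∀ {bs T₁ T₂} q tq → Compatible bs T₁ T₂ →
    Compatible (q ∷ bs) (replaceSet eqX q tq T₁) (replaceSet eqY (f q) tq T₂)
  replaceSet-compatible {bs} {T₁} {T₂} q tq compat = record
    { inhabited₁ = replaced eqX T₁ (inhabited₁ compat)
    ; inhabited₂ = replaced eqY T₂ (inhabited₂ compat)
    ; bound-uniform = uniform
    }
    where
    open Compatible
    replaced : ∀ {Z} (eq : DecidableEquality Z) (T : TraceSet Z) {x} →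
               Σ (Trace Z) T → Σ (Trace Z) (replaceSet eq x tq T)
    replaced eq T {x} (t , Tt) = updTrace eq x tq t , t , Tt , λ _ _ → refl
    uniform : ∀ q′ → q′ ∈ q ∷ bs → Σ (ℕ → Bool) λ c →
      Uniform eqX (replaceSet eqX q tq T₁) q′ c × Uniform eqY (replaceSet eqY (f q) tq T₂) (f q′) c
    uniform q′ q′∈ with eqX q′ q
    ... | yes refl = tq , replaceSet-uniform eqX q tq , replaceSet-uniform eqY (f q) tq
    uniform q′ (here q′≡q) | no q′≢q = ⊥-elim (q′≢q q′≡q)
    uniform q′ (there q′∈bs) | no q′≢q =
      let c , unif₁ , unif₂ = bound-uniform compat q′ q′∈bs
      in c , replaceSet-preserves-uniform eqX q tq q′≢q unif₁
           , replaceSet-preserves-uniform eqY (f q) tq (q′≢q ∘ f-injective) unif₂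

  labHolds-rename : ∀ {m₁ m₂} i p → Pointwise _≈_ m₁ m₂ → labHolds m₁ i p ⇔ labHolds m₂ i (f p)
  labHolds-rename i p (just t≈u) = mk⇔ (trans (t≈u i p)) (trans (sym (t≈u i p)))
  labHolds-rename i p nothing = ⇔.refl

  sat-mapQF : ∀ {P : ℕ → Set} ψ {bs T₁ T₂ Π₁ Π₂} i →
              ClosedUnder bs ψ → TraceVarsIn P ψ → Compatible bs T₁ T₂ →
              (∀ π → P π → Pointwise _≈_ (Π₁ π) (Π₂ π)) →
              sat eqX T₁ Π₁ i ψ ⇔ sat eqY T₂ Π₂ i (mapQF f ψ)
  sat-mapQF (∃q q ψ) i cl vars compat Π₁≈Π₂ =
    Σ-cong-⇔ λ tq → sat-mapQF ψ i cl vars (replaceSet-compatible q tq compat) Π₁≈Π₂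
  sat-mapQF (∀q q ψ) i cl vars compat Π₁≈Π₂ =
    Π-cong-⇔ λ tq → sat-mapQF ψ i cl vars (replaceSet-compatible q tq compat) Π₁≈Π₂
  sat-mapQF (lab p π) i cl vars compat Π₁≈Π₂ = labHolds-rename i p (Π₁≈Π₂ π vars)
  sat-mapQF (unl q) i cl vars compat Π₁≈Π₂ =
    let open Compatible compat
        c , unif₁ , unif₂ = bound-uniform q cl
    in ⇔.trans (uniform-sat-unl eqX inhabited₁ unif₁ i) (⇔.sym (uniform-sat-unl eqY inhabited₂ unif₂ i))
  sat-mapQF (¬f ψ) i cl vars compat Π₁≈Π₂ = ¬-cong-⇔ (sat-mapQF ψ i cl vars compat Π₁≈Π₂)
  sat-mapQF (ψ ∨f ψ₁) i (cl , cl₁) (vars , vars₁) compat Π₁≈Π₂ =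
    sat-mapQF ψ i cl vars compat Π₁≈Π₂ ⊎-⇔ sat-mapQF ψ₁ i cl₁ vars₁ compat Π₁≈Π₂
  sat-mapQF (Xf ψ) i cl vars compat Π₁≈Π₂ = sat-mapQF ψ (suc i) cl vars compat Π₁≈Π₂
  sat-mapQF (ψ Uf ψ₁) i (cl , cl₁) (vars , vars₁) compat Π₁≈Π₂ =
    Σ-cong-⇔ λ j → ⇔.refl
                ×-⇔ sat-mapQF ψ₁ j cl₁ vars₁ compat Π₁≈Π₂
                ×-⇔ (Π-cong-⇔ λ j′ → Π-cong-⇔ λ _ → Π-cong-⇔ λ _ → sat-mapQF ψ j′ cl vars compat Π₁≈Π₂)

module Connectives {Z : Set} (eq : DecidableEquality Z) (EM : ExcludedMiddle 0ℓ)
                   (T : TraceSet Z) (Π : Assign Z) (i : ℕ) where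

  private
    ⊨_ : QF Z → Set
    ⊨ ψ = sat eq T Π i ψ

  ∧f-intro : ∀ {ψ ψ′} → ⊨ ψ → ⊨ ψ′ → ⊨ (ψ ∧f ψ′)
  ∧f-intro ⊨ψ ⊨ψ′ (inj₁ ⊭ψ) = ⊭ψ ⊨ψ
  ∧f-intro ⊨ψ ⊨ψ′ (inj₂ ⊭ψ′) = ⊭ψ′ ⊨ψ′

  andAll-intro : ∀ {A : Set} {ψ} (f : A → QF Z) xs → ⊨ ψ → (∀ x → ⊨ f x) → ⊨ andAll ψ (map f xs)
  andAll-intro f [] ⊨ψ ⊨f = ⊨ψ
  andAll-intro {ψ = ψ} f (x ∷ xs) ⊨ψ ⊨f =
    ∧f-intro {f x} {andAll ψ (map f xs)} (⊨f x) (andAll-intro f xs ⊨ψ ⊨f)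

  ∨f-¬f : ∀ ψ → ⊨ (ψ ∨f ¬f ψ)
  ∨f-¬f ψ with EM {⊨ ψ}
  ... | yes ⊨ψ = inj₁ ⊨ψ
  ... | no ⊭ψ = inj₂ ⊭ψ

  ⇒f-intro : ∀ {ψ ψ′} → (⊨ ψ → ⊨ ψ′) → ⊨ (ψ ⇒f ψ′)
  ⇒f-intro {ψ} ⊨ψ→⊨ψ′ with ∨f-¬f ψ
  ... | inj₁ ⊨ψ = inj₂ (⊨ψ→⊨ψ′ ⊨ψ)
  ... | inj₂ ⊭ψ = inj₁ ⊭ψ

  ⇔f-intro : ∀ {ψ ψ′} → ⊨ ψ ⇔ ⊨ ψ′ → ⊨ (ψ ⇔f ψ′)
  ⇔f-intro {ψ} {ψ′} ψ⇔ψ′ =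
    ∧f-intro {ψ ⇒f ψ′} {ψ′ ⇒f ψ} (⇒f-intro {ψ} {ψ′} (Equivalence.to ψ⇔ψ′))
                                 (⇒f-intro {ψ′} {ψ} (Equivalence.from ψ⇔ψ′))

⇒f-elim : {Z : Set} (eq : DecidableEquality Z) {T : TraceSet Z} {Π : Assign Z} {i : ℕ} {ψ ψ′ : QF Z} →
          sat eq T Π i (ψ ⇒f ψ′) → sat eq T Π i ψ → sat eq T Π i ψ′
⇒f-elim eq (inj₁ ⊭ψ) ⊨ψ = ⊥-elim (⊭ψ ⊨ψ)
⇒f-elim eq (inj₂ ⊨ψ′) _ = ⊨ψ′

Gf-intro : {Z : Set} (eq : DecidableEquality Z) {T : TraceSet Z} {Π : Assign Z} {i : ℕ} {ψ : QF Z} →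
           (∀ j → i ≤ j → sat eq T Π j ψ) → sat eq T Π i (Gf ψ)
Gf-intro eq ⊨ψ (j , i≤j , ⊭ψ , _) = ⊭ψ (⊨ψ j i≤j)

module CausalFixpoint {A : Set} (a₀ : A) (next : (ℕ → A) → ℕ → A)
  (next-causal : ∀ {μ μ′ j} → (∀ {i} → i < j → μ i ≡ μ′ i) → next μ j ≡ next μ′ j) where

  private
    truncate : ∀ {j} → WfRec _<_ (λ _ → A) j → ℕ → A
    truncate {j} IH i with i <? j
    ... | yes i<j = IH i<j
    ... | no _ = a₀

    step : ∀ j → WfRec _<_ (λ _ → A) j → A
    step j IH = next (truncate IH) j

    truncate-cong : ∀ {j} {IH IH′ : WfRec _<_ (λ _ → A) j} →
                    (∀ {i} (i<j : i < j) → IH i<j ≡ IH′ i<j) →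
                    ∀ i → truncate IH i ≡ truncate IH′ i
    truncate-cong {j} IH≡IH′ i with i <? j
    ... | yes i<j = IH≡IH′ i<j
    ... | no _ = refl

    step-ext : ∀ j {IH IH′ : WfRec _<_ (λ _ → A) j} → (∀ {i} (i<j : i < j) → IH i<j ≡ IH′ i<j) →
               step j IH ≡ step j IH′
    step-ext j IH≡IH′ = next-causal (λ {i} _ → truncate-cong IH≡IH′ i)

  -- Opaque: letting the type checker unfold the well-founded recursion is prohibitively expensive.
  opaque
    fixpoint : ℕ → A
    fixpoint = All.wfRec <-wellFounded 0ℓ (λ _ → A) step

    fixpoint-unfold : ∀ j → fixpoint j ≡ next fixpoint j
    fixpoint-unfold j = trans (FixPoint.unfold-wfRec <-wellFounded (λ _ → A) step step-ext) (next-causal truncated)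
      where
      truncated : ∀ {i} → i < j → truncate {j} (λ {y} _ → fixpoint y) i ≡ fixpoint i
      truncated {i} i<j with i <? j
      ... | yes _ = refl
      ... | no i≮j = ⊥-elim (i≮j i<j)

module Plays {X V : Set} (eq : DecidableEquality X) (T′ : TS X V) {k′ : ℕ}
             (B : DPA (Vec (Letter X) (suc k′))) where
  open Game eq T′ B
  open TS T′
  open DPA B
  open Pos

  player : ℕ → Fin K
  player j = j mod K

  round : ℕ → ℕ
  round j = j / K

  player-at : ∀ r {s} (s<K : s < K) → player (s + r * K) ≡ fromℕ< s<K
  player-at r {s} s<K = FinP.toℕ-injective (begin
    toℕ (player (s + r * K)) ≡⟨ FinP.toℕ-fromℕ< _ ⟩
    (s + r * K) % K          ≡⟨ [m+kn]%n≡m%n s r K ⟩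
    s % K                    ≡⟨ m<n⇒m%n≡m s<K ⟩
    s                        ≡⟨ FinP.toℕ-fromℕ< s<K ⟨
    toℕ (fromℕ< s<K)         ∎)
    where open ≡-Reasoning

  round-at : ∀ r {s} → s < K → round (s + r * K) ≡ r
  round-at r {s} s<K = begin
    (s + r * K) / K     ≡⟨ +-distrib-/ s (r * K) no-carry ⟩
    s / K + r * K / K   ≡⟨ cong₂ _+_ (m<n⇒m/n≡0 s<K) (m*n/n≡m r K) ⟩
    r                   ∎
    where
    open ≡-Reasoning
    no-carry : s % K + r * K % K < K
    no-carry = subst (_< K) (sym (trans (cong₂ _+_ (m<n⇒m%n≡m s<K) (m*n%n≡0 r K)) (+-identityʳ s))) s<K

  player+round : ∀ j → toℕ (player j) + round j * K ≡ j
  player+round j = trans (cong (_+ round j * K) (FinP.toℕ-fromℕ< _)) (sym (m≡m%n+[m/n]*n j K))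

  stepAux-within : ∀ xs′ q₀ i (lt : suc (toℕ i) < K) → stepAux xs′ q₀ i ≡ pos xs′ q₀ (fromℕ< lt)
  stepAux-within xs′ q₀ i lt with suc (toℕ i) <? K
  ... | yes _ = refl
  ... | no ≮ = ⊥-elim (≮ lt)

  stepAux-wrap : ∀ xs′ q₀ i → toℕ i ≡ k′ →
                 stepAux xs′ q₀ i ≡ pos xs′ (δ q₀ (Vec.map letterOf xs′)) fzero
  stepAux-wrap xs′ q₀ i i≡k′ with suc (toℕ i) <? K
  ... | yes lt = ⊥-elim (<-irrefl refl (subst (λ m → suc m < K) i≡k′ lt))
  ... | no _ = refl

  assignW-lt : ∀ w {π} (π<K : π < K) → assignW w π ≡ just (comp w (fromℕ< π<K))
  assignW-lt w {π} π<K with π <? K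
  ... | yes _ = refl
  ... | no π≮K = ⊥-elim (π≮K π<K)

  data Split : ℕ → Set where
    split : ∀ r s (s<K : s < K) → Split (s + r * K)

  divide : ∀ j → Split j
  divide j = subst Split (player+round j) (split (round j) (toℕ (player j)) (FinP.toℕ<n (player j)))

  allJust-true : ∀ {m} (ys : Vec (Maybe V) m) → (∀ c → Σ V λ v → lookup ys c ≡ just v) →
                 allJust ys ≡ true
  allJust-true Vec.[] _ = refl
  allJust-true (y Vec.∷ ys) all with all fzero
  ... | _ , refl = allJust-true ys (all ∘ fsuc)

  module Snapshots (μ : ℕ → V) where

    move : Fin K → ℕ → V
    move c r = μ (toℕ c + r * K)

    letters : ℕ → Vec (Letter X) K
    letters r = tabulate λ c → λl (move c r)

    earlier : ℕ → Fin K → Maybe V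
    earlier zero c = nothing
    earlier (suc r) c = just (move c r)

    at : ℕ → ℕ → Pos
    at r s = posAt μ (s + r * K)

    record Snapshot (r s : ℕ) (s<K : s < K) : Set where
      field
        idx-at : idx (at r s) ≡ fromℕ< s<K
        state-at : q (at r s) ≡ run B letters r
        moved : ∀ c → toℕ c < s → lookup (xs (at r s)) c ≡ just (move c r)
        waiting : ∀ c → s ≤ toℕ c → lookup (xs (at r s)) c ≡ earlier r c

      toℕ-idx : toℕ (idx (at r s)) ≡ s
      toℕ-idx = trans (cong toℕ idx-at) (FinP.toℕ-fromℕ< s<K)

      updated : Vec (Maybe V) K
      updated = xs (at r s) [ idx (at r s) ]≔ just (μ (s + r * K))

      updated-moved : ∀ c → toℕ c ≤ s → lookup updated c ≡ just (move c r)
      updated-moved c c≤s with m≤n⇒m<n∨m≡n c≤s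
      ... | inj₁ c<s = trans (VecP.lookup∘update′ c≢idx (xs (at r s)) _) (moved c c<s)
        where c≢idx : c ≢ idx (at r s)
              c≢idx c≡idx = <-irrefl (trans (cong toℕ c≡idx) toℕ-idx) c<s
      ... | inj₂ refl = trans (cong (λ i → lookup (xs (at r s) [ i ]≔ _) c) idx≡c)
                              (VecP.lookup∘update c (xs (at r s)) _)
        where idx≡c : idx (at r s) ≡ c
              idx≡c = FinP.toℕ-injective toℕ-idx

      updated-waiting : ∀ c → s < toℕ c → lookup updated c ≡ earlier r c
      updated-waiting c s<c = trans (VecP.lookup∘update′ c≢idx (xs (at r s)) _) (waiting c (<⇒≤ s<c))
        where c≢idx : c ≢ idx (at r s)
              c≢idx c≡idx = <-irrefl (sym (trans (cong toℕ c≡idx) toℕ-idx)) s<c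

    open Snapshot

    k′<K : k′ < K
    k′<K = ≤-refl

    letters-complete : ∀ r → (S : Snapshot r k′ k′<K) → Vec.map letterOf (updated S) ≡ letters r
    letters-complete r S = trans (sym (VecP.tabulate∘lookup _)) (VecP.tabulate-cong λ c →
      trans (VecP.lookup-map c letterOf (updated S)) (cong letterOf (updated-moved S c (≤-pred (FinP.toℕ<n c)))))

    snapshot : ∀ r s (s<K : s < K) → Snapshot r s s<K
    snapshot zero zero s<K = record
      { idx-at = refl ; state-at = refl ; moved = λ c () ; waiting = λ c _ → VecP.lookup-replicate c nothing }
    snapshot (suc r) zero s<K = record
      { idx-at = cong idx wrap
      ; state-at = trans (cong q wrap) (cong₂ δ (state-at S) (letters-complete r S))
      ; moved = λ c ()
      ; waiting = λ c _ → trans (cong (λ p → lookup (xs p) c) wrap)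
                                (updated-moved S c (≤-pred (FinP.toℕ<n c)))
      }
      where
      S = snapshot r k′ k′<K
      wrap : at (suc r) 0 ≡ pos (updated S) (δ (q (at r k′)) (Vec.map letterOf (updated S))) fzero
      wrap = stepAux-wrap (updated S) _ _ (toℕ-idx S)
    snapshot r (suc s) s<K = record
      { idx-at = trans (cong idx within) (FinP.toℕ-injective (begin
          toℕ (fromℕ< next<K)      ≡⟨ FinP.toℕ-fromℕ< next<K ⟩
          suc (toℕ (idx (at r s))) ≡⟨ cong suc (toℕ-idx S) ⟩
          suc s                    ≡⟨ FinP.toℕ-fromℕ< s<K ⟨
          toℕ (fromℕ< s<K)         ∎))
      ; state-at = trans (cong q within) (state-at S)
      ; moved = λ c c<s → trans (cong (λ p → lookup (xs p) c) within) (updated-moved S c (≤-pred c<s))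
      ; waiting = λ c s<c → trans (cong (λ p → lookup (xs p) c) within) (updated-waiting S c s<c)
      }
      where
      S = snapshot r s (<-trans (n<1+n s) s<K)
      next<K : suc (toℕ (idx (at r s))) < K
      next<K = subst (λ m → suc m < K) (sym (toℕ-idx S)) s<K
      within : at r (suc s) ≡ pos (updated S) (q (at r s)) (fromℕ< next<K)
      within = stepAux-within (updated S) _ _ next<K
      open ≡-Reasoning

    idx-posAt : ∀ j → idx (posAt μ j) ≡ player j
    idx-posAt j with divide j
    ... | split r s s<K = trans (idx-at (snapshot r s s<K)) (sym (player-at r s<K))

    entry-at : ∀ r s (s<K : s < K) → lookup (xs (at r s)) (idx (at r s)) ≡ earlier r (fromℕ< s<K)
    entry-at r s s<K = let S = snapshot r s s<K in
      trans (cong (lookup (xs (at r s))) (idx-at S)) (waiting S _ (≤-reflexive (sym (FinP.toℕ-fromℕ< s<K))))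

    colour-later : ∀ r s (s<K : s < K) → colour (at (suc r) s) ≡ Ω (run B letters (suc r))
    colour-later r s s<K =
      trans (cong (λ b → if b then Ω (q (at (suc r) s)) else 0) (allJust-true (xs (at (suc r) s)) filled))
            (cong Ω (state-at S))
      where
      S = snapshot (suc r) s s<K
      filled : ∀ c → Σ V λ v → lookup (xs (at (suc r) s)) c ≡ just v
      filled c with toℕ c <? s
      ... | yes c<s = _ , moved S c c<s
      ... | no c≮s = _ , waiting S c (≮⇒≥ c≮s)

    accepts : ParityWin (colour ∘ posAt μ) → Accepts B letters
    accepts (m , m-even , m-often , N , m-max) = m , m-even , m-often′ , suc N , m-max′
      where
      m-often′ : ∀ N₀ → Σ ℕ λ r → N₀ ≤ r × Ω (run B letters r) ≡ m
      m-often′ N₀ with m-often (suc N₀ * K)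
      ... | j , N₀K≤j , colour≡m with divide j
      ... | split r s s<K with *-cancelʳ-< K (suc N₀) (suc r) (≤-<-trans N₀K≤j (+-monoˡ-< (r * K) s<K))
      ... | s≤s (s≤s {n = r₀} N₀≤r₀) =
        r , m≤n⇒m≤1+n N₀≤r₀ , trans (sym (colour-later r₀ s s<K)) colour≡m
      m-max′ : ∀ r → suc N ≤ r → Ω (run B letters r) ≤ m
      m-max′ (suc r) (s≤s N≤r) =
        subst (_≤ m) (colour-later r 0 0<K)
              (m-max (suc r * K) (≤-trans N≤r (≤-trans (n≤1+n r) (m≤m*n (suc r) K))))
        where 0<K : 0 < K
              0<K = s≤s z≤n

    comp-letters : ∀ c r → comp letters c r ≡ λl (move c r)
    comp-letters c r = VecP.lookup∘tabulate (λ c → λl (move c r)) c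

    legal-moves-are-paths : (∀ j → Legal (posAt μ j) (μ j)) → ∀ c → IsPath T′ (move c)
    legal-moves-are-paths legal c = legal-round 0 , legal-round ∘ suc
      where
      legal-round : ∀ r → LegalAt (earlier r c) (move c r)
      legal-round r = subst (λ x → LegalAt x (move c r))
        (trans (entry-at r (toℕ c) (FinP.toℕ<n c)) (cong (earlier r) (FinP.fromℕ<-toℕ c _)))
        (legal (toℕ c + r * K))

  open Snapshots using (move; idx-posAt)

  posAt-cong : ∀ {μ μ′} j → (∀ {i} → i < j → μ i ≡ μ′ i) → posAt μ j ≡ posAt μ′ j
  posAt-cong zero _ = refl
  posAt-cong (suc j) μ≡μ′ = cong₂ step (posAt-cong j (λ i<j → μ≡μ′ (m<n⇒m<1+n i<j))) (μ≡μ′ ≤-refl)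

  past-cong : ∀ c {μ μ′} j → (∀ {i} → i < j → μ i ≡ μ′ i) → past c μ j ≡ past c μ′ j
  past-cong c zero _ = refl
  past-cong c (suc zero) _ = refl
  past-cong c (suc (suc j)) μ≡μ′ =
    cong₂ (λ pst p → pst ++ (obs c p ∷ [])) (past-cong c (suc j) below) (posAt-cong (suc j) below)
    where below = λ {i} (i<1+j : i < suc j) → μ≡μ′ (m<n⇒m<1+n i<1+j)

  lookup-obs : ∀ c p → lookup (proj₁ (obs c p)) c ≡ lookup (xs p) c
  lookup-obs c p =
    trans (VecP.lookup∘tabulate (λ d → if toℕ d ≤ᵇ toℕ c then lookup (xs p) d else nothing) c)
          (cong (λ b → if b then lookup (xs p) c else nothing) c≤ᵇc)
    where c≤ᵇc : (toℕ c ≤ᵇ toℕ c) ≡ true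
          c≤ᵇc = Equivalence.to T-≡ (≤⇒≤ᵇ (≤-refl {toℕ c}))

  IsVerifier? : ∀ c → Dec (IsVerifier c)
  IsVerifier? c = toℕ c % 2 ≟ 1

  FalsifierLegal : (Fin K → ℕ → V) → Set
  FalsifierLegal F = (∀ c → VI (F c 0)) × (∀ c r → E (F c r) (F c (suc r)))

  module Outcome (σ : Strategies) (F : Fin K → ℕ → V) where

    respond : Obs → List Obs → ℕ → V
    respond o pst r with IsVerifier? (proj₂ o)
    ... | yes vi = proj₁ (σ (proj₂ o) vi pst o refl)
    ... | no _ = F (proj₂ o) r

    respond-verifier : ∀ o pst r (vi : IsVerifier (proj₂ o)) →
                       respond o pst r ≡ proj₁ (σ (proj₂ o) vi pst o refl)
    respond-verifier o pst r vi with IsVerifier? (proj₂ o)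
    ... | yes vi′ = cong (λ v → proj₁ (σ (proj₂ o) v pst o refl)) (≡-irrelevant vi′ vi)
    ... | no ¬vi = ⊥-elim (¬vi vi)

    respond-falsifier : ∀ o pst r → ¬ IsVerifier (proj₂ o) → respond o pst r ≡ F (proj₂ o) r
    respond-falsifier o pst r ¬vi with IsVerifier? (proj₂ o)
    ... | yes vi = ⊥-elim (¬vi vi)
    ... | no _ = refl

    next : (ℕ → V) → ℕ → V
    next μ j = respond (obs (idx (posAt μ j)) (posAt μ j)) (past (idx (posAt μ j)) μ j) (round j)

    next-causal : ∀ {μ μ′ j} → (∀ {i} → i < j → μ i ≡ μ′ i) → next μ j ≡ next μ′ j
    next-causal {μ} {μ′} {j} μ≡μ′ =
      trans (cong (λ p → respond (obs (idx p) p) (past (idx p) μ j) (round j)) (posAt-cong j μ≡μ′))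
            (cong (λ pst → respond (obs (idx p′) p′) pst (round j)) (past-cong _ j μ≡μ′))
      where p′ = posAt μ′ j

    open CausalFixpoint (proj₁ VIne) next next-causal public
      renaming (fixpoint to play; fixpoint-unfold to play-unfold)

    follows-σ : ∀ j i (vi : IsVerifier i) (e : idx (posAt play j) ≡ i) →
                play j ≡ proj₁ (σ i vi (past i play j) (obs i (posAt play j)) e)
    follows-σ j _ vi refl = trans (play-unfold j) (respond-verifier _ _ _ vi)

    play-falsifier : ∀ j → ¬ IsVerifier (player j) → play j ≡ F (player j) (round j)
    play-falsifier j ¬vi = trans (play-unfold j)
      (trans (respond-falsifier _ _ _ (¬vi ∘ subst IsVerifier idx≡)) (cong (λ c → F c (round j)) idx≡))
      where idx≡ = idx-posAt play j

    falsifier-moves : ∀ c r → ¬ IsVerifier c → move play c r ≡ F c r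
    falsifier-moves c r ¬vi =
      trans (play-falsifier _ (¬vi ∘ subst IsVerifier player≡c))
            (cong₂ F player≡c (round-at r (FinP.toℕ<n c)))
      where player≡c : player (toℕ c + r * K) ≡ c
            player≡c = trans (player-at r (FinP.toℕ<n c)) (FinP.fromℕ<-toℕ c _)

    legal : FalsifierLegal F → ∀ j → Legal (posAt play j) (play j)
    legal (F-initial , F-step) j with IsVerifier? (idx (posAt play j))
    ... | yes vi = subst (Legal p) (sym (follows-σ j c vi refl))
                     (subst (λ x → LegalAt x (proj₁ σ-move)) (lookup-obs c p) (proj₂ σ-move))
      where
      p = posAt play j
      c = idx p
      σ-move = σ c vi (past c play j) (obs c p) refl
    ... | no ¬vi with divide j
    ...   | split r s s<K = subst₂ LegalAt (sym (Snapshots.entry-at play r s s<K)) (sym play≡F) (F-legal r)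
      where
      c = fromℕ< s<K
      ¬vc : ¬ IsVerifier c
      ¬vc = ¬vi ∘ subst IsVerifier (sym (trans (idx-posAt play (s + r * K)) (player-at r s<K)))
      play≡F : play (s + r * K) ≡ F c r
      play≡F = trans (play-falsifier _ (¬vc ∘ subst IsVerifier (player-at r s<K)))
                     (cong₂ F (player-at r s<K) (round-at r s<K))
      F-legal : ∀ r → LegalAt (Snapshots.earlier play r c) (F c r)
      F-legal zero = F-initial c
      F-legal (suc r) = subst (λ v → E v (F c (suc r))) (sym (falsifier-moves c r ¬vc)) (F-step c r)

    consistent : FalsifierLegal F → Consistent σ play
    consistent F-legal j = legal F-legal j , follows-σ j

  module _ (t : ℕ) where

    AgreeUpTo : (ℕ → V) → (ℕ → V) → ℕ → Set
    AgreeUpTo μ μ′ j = ∀ {i} → i < j → toℕ (player i) ≤ t → μ i ≡ μ′ i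

    module _ {μ μ′ : ℕ → V} where
      open Snapshots
      open Snapshots.Snapshot

      agree-move : ∀ {j} d r → toℕ d ≤ t → toℕ d + r * K < j → AgreeUpTo μ μ′ j →
                   move μ d r ≡ move μ′ d r
      agree-move d r d≤t i<j agree = agree i<j (subst (λ c → toℕ c ≤ t) (sym player≡d) d≤t)
        where player≡d : player (toℕ d + r * K) ≡ d
              player≡d = trans (player-at r (FinP.toℕ<n d)) (FinP.fromℕ<-toℕ d _)

      agree-earlier : ∀ {s} r d → toℕ d ≤ t → AgreeUpTo μ μ′ (s + r * K) →
                      earlier μ r d ≡ earlier μ′ r d
      agree-earlier zero d d≤t agree = refl
      agree-earlier {s} (suc r) d d≤t agree = cong just (agree-move d r d≤t in-previous-round agree)
        where in-previous-round : toℕ d + r * K < s + suc r * K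
              in-previous-round = <-≤-trans (+-monoˡ-< (r * K) (FinP.toℕ<n d)) (m≤n+m (K + r * K) s)

      obs-agree : ∀ c j → toℕ c ≤ t → AgreeUpTo μ μ′ j → obs c (posAt μ j) ≡ obs c (posAt μ′ j)
      obs-agree c j c≤t agree with divide j
      ... | split r s s<K = cong₂ _,_ (VecP.tabulate-cong visible) (trans (idx-at S) (sym (idx-at S′)))
        where
        S = snapshot μ r s s<K
        S′ = snapshot μ′ r s s<K
        visible : ∀ d → (if toℕ d ≤ᵇ toℕ c then lookup (xs (at μ r s)) d else nothing)
                      ≡ (if toℕ d ≤ᵇ toℕ c then lookup (xs (at μ′ r s)) d else nothing)
        visible d with toℕ d ≤ᵇ toℕ c in d≤ᵇc
        ... | false = refl
        ... | true with toℕ d <? s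
        ...   | yes d<s = trans (moved S d d<s)
                                (trans (cong just (agree-move d r d≤t (+-monoˡ-< (r * K) d<s) agree)) (sym (moved S′ d d<s)))
          where d≤t = ≤-trans (≤ᵇ⇒≤ _ _ (Equivalence.from T-≡ d≤ᵇc)) c≤t
        ...   | no d≮s = trans (waiting S d (≮⇒≥ d≮s))
                               (trans (agree-earlier r d d≤t agree) (sym (waiting S′ d (≮⇒≥ d≮s))))
          where d≤t = ≤-trans (≤ᵇ⇒≤ _ _ (Equivalence.from T-≡ d≤ᵇc)) c≤t

      past-agree : ∀ c j → toℕ c ≤ t → AgreeUpTo μ μ′ j → past c μ j ≡ past c μ′ j
      past-agree c zero c≤t agree = refl
      past-agree c (suc zero) c≤t agree = refl
      past-agree c (suc (suc j)) c≤t agree =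
        cong₂ (λ pst o → pst ++ (o ∷ [])) (past-agree c (suc j) c≤t below) (obs-agree c (suc j) c≤t below)
        where below = λ {i} (i<1+j : i < suc j) → agree (m<n⇒m<1+n i<1+j)

    -- Imperfect information: Verifier-player c ≤ t only observes components ≤ c, so the moves on
    -- components ≤ t do not depend on what the Falsifier plays on components > t.
    module Independence (σ : Strategies) {F F′ : Fin K → ℕ → V}
                        (F≡F′ : ∀ c → toℕ c ≤ t → ∀ r → F c r ≡ F′ c r) where
      open Outcome σ F using (play; play-unfold; respond)
      open Outcome σ F′ using () renaming (play to play′; play-unfold to play′-unfold; respond to respond′)

      respond-agree : ∀ o pst r → toℕ (proj₂ o) ≤ t → respond o pst r ≡ respond′ o pst r
      respond-agree o pst r o≤t with IsVerifier? (proj₂ o)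
      ... | yes _ = refl
      ... | no _ = F≡F′ (proj₂ o) o≤t r

      plays-agree : ∀ j → AgreeUpTo play play′ j
      plays-agree (suc j) {i} i<1+j i≤t with m≤n⇒m<n∨m≡n (≤-pred i<1+j)
      ... | inj₁ i<j = plays-agree j i<j i≤t
      ... | inj₂ refl = begin
        play j ≡⟨ play-unfold j ⟩
        respond (obs (idx p) p) (past (idx p) play j) (round j)
          ≡⟨ cong₂ (λ c c′ → respond (obs c p) (past c′ play j) (round j)) idx≡ idx≡ ⟩
        respond (obs (player j) p) (past (player j) play j) (round j)
          ≡⟨ respond-agree _ _ _ (subst (λ c → toℕ c ≤ t) (sym idx≡) i≤t) ⟩
        respond′ (obs (player j) p) (past (player j) play j) (round j)
          ≡⟨ cong₂ (λ o pst → respond′ o pst (round j))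
                   (obs-agree _ j i≤t (plays-agree j)) (past-agree _ j i≤t (plays-agree j)) ⟩
        respond′ (obs (player j) p′) (past (player j) play′ j) (round j)
          ≡⟨ cong₂ (λ c c′ → respond′ (obs c p′) (past c′ play′ j) (round j)) idx≡′ idx≡′ ⟨
        respond′ (obs (idx p′) p′) (past (idx p′) play′ j) (round j)
          ≡⟨ play′-unfold j ⟨
        play′ j ∎
        where
        open ≡-Reasoning
        p = posAt play j
        p′ = posAt play′ j
        idx≡ = idx-posAt play j
        idx≡′ = idx-posAt play′ j

      moves-agree : ∀ c r → toℕ c ≤ t → move play c r ≡ move play′ c r
      moves-agree c r c≤t = agree-move c r c≤t ≤-refl (plays-agree (suc (toℕ c + r * K)))

module Soundness (EM : ExcludedMiddle 0ℓ) {a nV h′ : ℕ} (T : TS (Fin a) (Fin nV))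
  (ψ : QF (Fin a)) (ψ-closed : Closed ψ) (ψ-vars : TraceVarsIn (λ π → π < 2 * suc h′) ψ)
  (n : Fin (suc h′) → ℕ) (ξ : (i : Fin (suc h′)) → Fin (n i) → QF (Fin a))
  (ξ-wf : ∀ i ℓ → Closed (ξ i ℓ) × TraceVarsIn (λ π → Σ ℕ (λ j → j ≤ toℕ i × π ≡ 2 * j)) (ξ i ℓ))
  (B : DPA (Vec (Letter (AP' a h′ n)) (2 * suc h′)))
  (spec : Game.Spec (decAP' a h′ n) (manip n T) B (ψΞ ψ ξ))
  (σ : Game.Strategies (decAP' a h′ n) (manip n T) B)
  (σ-wins : Game.Winning (decAP' a h′ n) (manip n T) B σ) where

  H : ℕ
  H = suc h′

  _≟ᵃ_ : DecidableEquality (Fin a)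
  _≟ᵃ_ = FinP._≟_

  _≟′_ : DecidableEquality (AP' a h′ n)
  _≟′_ = decAP' a h′ n

  T′ : TS (AP' a h′ n) (VP (Fin nV) h′ n)
  T′ = manip n T

  open Game _≟′_ T′ B
  open Plays _≟′_ T′ B
  open Snapshots using (move)
  open TS T using (λl; VIne; total)

  Path : Set
  Path = Σ (ℕ → Fin nV) (IsPath T)

  traceOf : Path → Trace (Fin a)
  traceOf (p , _) r = λl (p r)

  somePath : Path
  somePath = walk , proj₂ VIne , λ r → proj₂ (total (walk r))
    where walk : ℕ → Fin nV
          walk zero = proj₁ VIne
          walk (suc r) = proj₁ (total (walk r))

  some-trace : Σ (Trace (Fin a)) (traces T)
  some-trace = traceOf somePath , proj₁ somePath , proj₂ somePath , λ _ _ → refl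

  Choice : Set
  Choice = Vector Path H

  even odd : Fin H → Fin K
  even i = fromℕ< (m<n⇒2m<2n (FinP.toℕ<n i))
  odd i = fromℕ< (m<n⇒1+2m<2n (FinP.toℕ<n i))

  copy : Fin K → Fin H
  copy c = fromℕ< (n<2m⇒⌊n/2⌋<m (FinP.toℕ<n c))

  copy-even : ∀ i → copy (even i) ≡ i
  copy-even i = FinP.toℕ-injective (begin
    toℕ (copy (even i))        ≡⟨ FinP.toℕ-fromℕ< _ ⟩
    ⌊ toℕ (even i) /2⌋         ≡⟨ cong ⌊_/2⌋ (FinP.toℕ-fromℕ< _) ⟩
    ⌊ 2 * toℕ i /2⌋            ≡⟨ ⌊2n/2⌋≡n (toℕ i) ⟩
    toℕ i                      ∎)
    where open ≡-Reasoning

  variable-of : ∀ {π} → π < 2 * H → Σ (Fin H) λ j → π ≡ 2 * toℕ j ⊎ π ≡ suc (2 * toℕ j)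
  variable-of {π} π<K =
    j , Sum.map (λ e → trans e (cong (2 *_) toℕ-j)) (λ e → trans e (cong (suc ∘ (2 *_)) toℕ-j))
                (n≡2⌊n/2⌋⊎n≡1+2⌊n/2⌋ π)
    where j = fromℕ< (n<2m⇒⌊n/2⌋<m π<K)
          toℕ-j = sym (FinP.toℕ-fromℕ< (n<2m⇒⌊n/2⌋<m π<K))

  even-falsifier : ∀ i → ¬ IsVerifier (even i)
  even-falsifier i verifier = 0≢1+n (begin
    0                   ≡⟨ m*n%n≡0 (toℕ i) 2 ⟨
    toℕ i * 2 % 2       ≡⟨ cong (_% 2) (*-comm (toℕ i) 2) ⟩
    2 * toℕ i % 2       ≡⟨ cong (_% 2) (FinP.toℕ-fromℕ< (m<n⇒2m<2n (FinP.toℕ<n i))) ⟨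
    toℕ (even i) % 2    ≡⟨ verifier ⟩
    1                   ∎)
    where open ≡-Reasoning

  -- Odd variables get junk values; the ξ_{i,ℓ} never mention them.
  ξ-assign : Choice → Assign (Fin a)
  ξ-assign Ps π with ⌊ π /2⌋ <? H
  ... | yes π/2<H = just (traceOf (Ps (fromℕ< π/2<H)))
  ... | no _ = nothing

  ξ-assign-even : ∀ Ps i → ξ-assign Ps (2 * toℕ i) ≡ just (traceOf (Ps i))
  ξ-assign-even Ps i with ⌊ 2 * toℕ i /2⌋ <? H
  ... | yes lt =
    cong (λ j → just (traceOf (Ps j))) (FinP.toℕ-injective (trans (FinP.toℕ-fromℕ< lt) (⌊2n/2⌋≡n (toℕ i))))
  ... | no ≮H = ⊥-elim (≮H (subst (_< H) (sym (⌊2n/2⌋≡n (toℕ i))) (FinP.toℕ<n i)))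

  EvenUpTo : Fin H → ℕ → Set
  EvenUpTo i π = Σ ℕ (λ j → j ≤ toℕ i × π ≡ 2 * j)

  even-var : ∀ i {π} → EvenUpTo i π → Σ (Fin H) λ j → toℕ j ≤ toℕ i × π ≡ 2 * toℕ j
  even-var i (j , j≤i , refl) = fromℕ< j<H , subst (_≤ toℕ i) (sym toℕ-j) j≤i , cong (2 *_) (sym toℕ-j)
    where j<H = ≤-<-trans j≤i (FinP.toℕ<n i)
          toℕ-j = FinP.toℕ-fromℕ< j<H

  ξ-holds : Choice → (i : Fin H) → Fin (n i) → ℕ → Set
  ξ-holds Ps i ℓ r = sat _≟ᵃ_ (traces T) (ξ-assign Ps) r (ξ i ℓ)

  -- Stored as the lookup of a vector, so that labellings from agreeing choices are provably equal
  -- without function extensionality.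
  labels : Choice → (i : Fin H) → ℕ → Fin (n i) → Bool
  labels Ps i r = lookup (tabulate λ ℓ → ⌊ EM {ξ-holds Ps i ℓ r} ⌋)

  -- On odd components the Falsifier never moves, so the value there is irrelevant.
  falsifier : Choice → Fin K → ℕ → VP (Fin nV) h′ n
  falsifier Ps c r = copy c , proj₁ (Ps (copy c)) r , labels Ps (copy c) r

  falsifier-legal : ∀ Ps → FalsifierLegal (falsifier Ps)
  falsifier-legal Ps = (λ c → proj₁ (proj₂ (Ps (copy c))))
                     , (λ c r → refl , proj₂ (proj₂ (Ps (copy c))) r)

  play : Choice → ℕ → VP (Fin nV) h′ n
  play Ps = Outcome.play σ (falsifier Ps)

  play-consistent : ∀ Ps → Consistent σ (play Ps)
  play-consistent Ps = Outcome.consistent σ (falsifier Ps) (falsifier-legal Ps)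

  witness : Choice → Fin H → Trace (Fin a)
  witness Ps i r = λl (proj₁ (proj₂ (move (play Ps) (odd i) r)))

  witness-traces : ∀ Ps i → traces T (witness Ps i)
  witness-traces Ps i =
    vertex ∘ move (play Ps) (odd i) , (proj₁ path , λ r → proj₂ (proj₂ path r)) , λ _ _ → refl
    where vertex = proj₁ ∘ proj₂
          path = Snapshots.legal-moves-are-paths (play Ps) (proj₁ ∘ play-consistent Ps) (odd i)

  SameUpTo : Choice → Choice → ℕ → Set
  SameUpTo Ps Ps′ m = ∀ j → toℕ j ≤ m → Ps j ≡ Ps′ j

  module Id = Renaming _≟ᵃ_ _≟ᵃ_ id id

  ξ-holds-agree : ∀ {Ps Ps′} i ℓ r → SameUpTo Ps Ps′ (toℕ i) → ξ-holds Ps i ℓ r ⇔ ξ-holds Ps′ i ℓ r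
  ξ-holds-agree {Ps} {Ps′} i ℓ r same =
    subst (λ φ → ξ-holds Ps i ℓ r ⇔ sat _≟ᵃ_ (traces T) (ξ-assign Ps′) r φ) (mapQF-id (ξ i ℓ))
          (Id.sat-mapQF (ξ i ℓ) r (proj₁ (ξ-wf i ℓ)) (proj₂ (ξ-wf i ℓ))
                        (Id.compatible-[] some-trace some-trace) related)
    where
    related : ∀ π → EvenUpTo i π → Pointwise Id._≈_ (ξ-assign Ps π) (ξ-assign Ps′ π)
    related π π-even with even-var i π-even
    ... | j , j≤i , refl rewrite ξ-assign-even Ps j | ξ-assign-even Ps′ j | same j j≤i = just λ _ _ → refl

  labels-agree : ∀ {Ps Ps′} i → SameUpTo Ps Ps′ (toℕ i) → ∀ r → labels Ps i r ≡ labels Ps′ i r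
  labels-agree i same r = cong lookup (VecP.tabulate-cong λ ℓ → isYes-cong EM EM (ξ-holds-agree i ℓ r same))

  falsifier-agree : ∀ {Ps Ps′} m → SameUpTo Ps Ps′ m →
                    ∀ c → toℕ c ≤ suc (2 * m) → ∀ r → falsifier Ps c r ≡ falsifier Ps′ c r
  falsifier-agree m same c c≤ r =
    cong₂ (λ P A → copy c , proj₁ P r , A) (same (copy c) copy≤m)
          (labels-agree (copy c) (λ j j≤ → same j (≤-trans j≤ copy≤m)) r)
    where copy≤m : toℕ (copy c) ≤ m
          copy≤m = subst (_≤ m) (sym (FinP.toℕ-fromℕ< _)) (n≤1+2m⇒⌊n/2⌋≤m c≤)

  witness-agree : ∀ {Ps Ps′} i → SameUpTo Ps Ps′ (toℕ i) → ∀ r x → witness Ps i r x ≡ witness Ps′ i r x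
  witness-agree {Ps} {Ps′} i same r x = cong (λ v → λl (proj₁ (proj₂ v)) x) (moves-agree (odd i) r ≤-refl)
    where
    toℕ-odd : toℕ (odd i) ≡ suc (2 * toℕ i)
    toℕ-odd = FinP.toℕ-fromℕ< (m<n⇒1+2m<2n (FinP.toℕ<n i))
    same-falsifier : ∀ c → toℕ c ≤ toℕ (odd i) → ∀ r → falsifier Ps c r ≡ falsifier Ps′ c r
    same-falsifier c c≤ = falsifier-agree (toℕ i) same c (subst (toℕ c ≤_) toℕ-odd c≤)
    open Independence (toℕ (odd i)) σ same-falsifier

  _≗ᵗ_ : Trace (Fin a) → Trace (Fin a) → Set
  t ≗ᵗ u = ∀ r x → t r x ≡ u r x

  Matched : Choice → Assign (Fin a) → Fin H → Set
  Matched Ps Π j = Pointwise _≗ᵗ_ (Π (2 * toℕ j)) (just (traceOf (Ps j)))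
                 × Pointwise _≗ᵗ_ (Π (suc (2 * toℕ j))) (just (witness Ps j))

  Matches : Choice → Assign (Fin a) → ℕ → Set
  Matches Ps Π m = ∀ j → toℕ j < m → Matched Ps Π j

  module ToAP′ = Renaming _≟ᵃ_ _≟′_ inj₁ inj₁-injective

  labP-same : ∀ {j i} → j ≡ i → (A : (k : Fin H) → Fin (n k) → Bool) → ∀ ℓ → labP j (A j) i ℓ ≡ A i ℓ
  labP-same {i = i} refl A ℓ with i FinP.≟ i
  ... | yes refl = refl
  ... | no i≢i = ⊥-elim (i≢i refl)

  module Matrix (Ps : Choice) where

    w : ℕ → Vec (Letter (AP' a h′ n)) K
    w = Snapshots.letters (play Ps)

    Holds : ℕ → QF (AP' a h′ n) → Set
    Holds = sat _≟′_ (traces T′) (assignW w)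

    spec-holds : (∀ c → traces T′ (comp w c)) × Holds 0 (ψΞ ψ ξ)
    spec-holds = Equivalence.to (spec w) (Snapshots.accepts (play Ps) (σ-wins (play Ps) (play-consistent Ps)))

    open Outcome σ (falsifier Ps) using (falsifier-moves)

    even-letter : ∀ i r → comp w (even i) r ≡ TS.λl T′ (falsifier Ps (even i) r)
    even-letter i r = trans (Snapshots.comp-letters (play Ps) (even i) r)
                            (cong (TS.λl T′) (falsifier-moves (even i) r (even-falsifier i)))

    assignW-even : ∀ i → assignW w (2 * toℕ i) ≡ just (comp w (even i))
    assignW-even i = assignW-lt w (m<n⇒2m<2n (FinP.toℕ<n i))

    assignW-odd : ∀ i → assignW w (suc (2 * toℕ i)) ≡ just (comp w (odd i))
    assignW-odd i = assignW-lt w (m<n⇒1+2m<2n (FinP.toℕ<n i))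

    even-component : ∀ i → traceOf (Ps i) ToAP′.≈ comp w (even i)
    even-component i r x =
      trans (cong (λ f → f (inj₁ x)) (even-letter i r)) (cong (λ j → λl (proj₁ (Ps j) r) x) (copy-even i))

    odd-component : ∀ i → witness Ps i ToAP′.≈ comp w (odd i)
    odd-component i r x = cong (λ f → f (inj₁ x)) (Snapshots.comp-letters (play Ps) (odd i) r)

    m-holds : ∀ i → comp w (even i) 0 (mProp i) ≡ true
    m-holds i =
      trans (cong (λ f → f (mProp i)) (even-letter i 0)) (isYes-true (i FinP.≟ copy (even i)) (sym (copy-even i)))

    p-holds : ∀ i ℓ r → comp w (even i) r (pProp i ℓ) ≡ labels Ps i r ℓ
    p-holds i ℓ r =
      trans (cong (λ f → f (pProp i ℓ)) (even-letter i r)) (labP-same (copy-even i) (λ k → labels Ps k r) ℓ)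

    compatible : ToAP′.Compatible [] (traces T) (traces T′)
    compatible = ToAP′.compatible-[] some-trace (comp w fzero , proj₁ spec-holds fzero)

    even-related : ∀ j → Pointwise ToAP′._≈_ (ξ-assign Ps (2 * toℕ j)) (assignW w (2 * toℕ j))
    even-related j =
      subst₂ (Pointwise ToAP′._≈_) (sym (ξ-assign-even Ps j)) (sym (assignW-even j)) (just (even-component j))

    ξ-related : ∀ i π → EvenUpTo i π → Pointwise ToAP′._≈_ (ξ-assign Ps π) (assignW w π)
    ξ-related i π π-even = let j , _ , π≡2j = even-var i π-even in
      subst (λ π → Pointwise ToAP′._≈_ (ξ-assign Ps π) (assignW w π)) (sym π≡2j) (even-related j)

    module At (r : ℕ) = Connectives _≟′_ EM (traces T′) (assignW w) r

    p⇔ξ : ∀ i ℓ r → labHolds (assignW w (2 * toℕ i)) r (pProp i ℓ) ⇔ Holds r (embed (ξ i ℓ))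
    p⇔ξ i ℓ r = begin
      labHolds (assignW w (2 * toℕ i)) r (pProp i ℓ)
        ≡⟨ cong (λ m → labHolds m r (pProp i ℓ)) (assignW-even i) ⟩
      comp w (even i) r (pProp i ℓ) ≡ true
        ∼⟨ mk⇔ (trans (sym (p-holds i ℓ r))) (trans (p-holds i ℓ r)) ⟩
      labels Ps i r ℓ ≡ true
        ∼⟨ mk⇔ (trans (sym label≡)) (trans label≡) ⟩
      ⌊ EM ⌋ ≡ true
        ∼⟨ isYes-true⇔ EM ⟩
      ξ-holds Ps i ℓ r
        ∼⟨ ToAP′.sat-mapQF (ξ i ℓ) r (proj₁ (ξ-wf i ℓ)) (proj₂ (ξ-wf i ℓ)) compatible (ξ-related i) ⟩
      Holds r (embed (ξ i ℓ)) ∎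
      where
      open EquationalReasoning {k = equivalence}
      label≡ : labels Ps i r ℓ ≡ ⌊ EM ⌋
      label≡ = VecP.lookup∘tabulate (λ ℓ → ⌊ EM {ξ-holds Ps i ℓ r} ⌋) ℓ

    premises : QF (AP' a h′ n)
    premises = andAll (tautU fzero) (map (conjunctU ξ) (allFin H))

    premise : Holds 0 premises
    premise = At.andAll-intro 0 (conjunctU ξ) (allFin H) (At.∨f-¬f 0 (lab (mProp fzero) 0)) conjunct
      where
      m-lab : ∀ i → labHolds (assignW w (2 * toℕ i)) 0 (mProp i)
      m-lab i = subst (λ m → labHolds m 0 (mProp i)) (sym (assignW-even i)) (m-holds i)
      conjunct : ∀ i → Holds 0 (conjunctU ξ i)
      conjunct i =
        At.∧f-intro 0 {lab (mProp i) (2 * toℕ i)} {Gf labelling} (m-lab i) (Gf-intro _≟′_ {ψ = labelling} λ r _ →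
          At.andAll-intro r {ψ = tautU i} p⇔ξf (allFin (n i)) (At.∨f-¬f r (lab (mProp i) (2 * toℕ i))) λ ℓ →
            At.⇔f-intro r {lab (pProp i ℓ) (2 * toℕ i)} {embed (ξ i ℓ)} (p⇔ξ i ℓ r))
        where
        p⇔ξf : Fin (n i) → QF (AP' a h′ n)
        p⇔ξf ℓ = lab (pProp i ℓ) (2 * toℕ i) ⇔f embed (ξ i ℓ)
        labelling = andAll (tautU i) (map p⇔ξf (allFin (n i)))

    transport : ∀ {mt u v} → Pointwise _≗ᵗ_ mt (just u) → u ToAP′.≈ v → Pointwise ToAP′._≈_ mt (just v)
    transport (just t≗u) u≈v = just λ r x → trans (u≈v r x) (sym (t≗u r x))

    module _ (Π : Assign (Fin a)) (match : Matches Ps Π H) where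

      Related : ℕ → Set
      Related π = Pointwise ToAP′._≈_ (Π π) (assignW w π)

      even-match : ∀ j → Related (2 * toℕ j)
      even-match j = subst (Pointwise ToAP′._≈_ (Π (2 * toℕ j))) (sym (assignW-even j))
                           (transport (proj₁ (match j (FinP.toℕ<n j))) (even-component j))

      odd-match : ∀ j → Related (suc (2 * toℕ j))
      odd-match j = subst (Pointwise ToAP′._≈_ (Π (suc (2 * toℕ j)))) (sym (assignW-odd j))
                          (transport (proj₂ (match j (FinP.toℕ<n j))) (odd-component j))

      matching-related : ∀ π → π < 2 * H → Related π
      matching-related π π<K = let j , π-parity = variable-of π<K in
        Sum.[ (λ π≡2j → subst Related (sym π≡2j) (even-match j))
            , (λ π≡2j+1 → subst Related (sym π≡2j+1) (odd-match j)) ]′ π-parity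

    ψ-holds : ∀ Π → Matches Ps Π H → sat _≟ᵃ_ (traces T) Π 0 ψ
    ψ-holds Π match =
      Equivalence.from (ToAP′.sat-mapQF ψ 0 ψ-closed ψ-vars compatible (matching-related Π match))
                       (⇒f-elim _≟′_ {ψ = premises} {ψ′ = embed ψ} (proj₂ spec-holds) premise)

  retarget : ∀ {mt u u′} → Pointwise _≗ᵗ_ mt (just u) → u ≗ᵗ u′ → Pointwise _≗ᵗ_ mt (just u′)
  retarget (just t≗u) u≗u′ = just λ r x → trans (t≗u r x) (u≗u′ r x)

  alternation : ∀ h m {off} → m + h ≡ H → off ≡ 2 * m →
                ∀ Ps Π → Matches Ps Π m → satH _≟ᵃ_ (traces T) Π 0 (alt h off ψ)
  alternation zero m m+0≡H _ Ps Π match =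
    Matrix.ψ-holds Ps Π (subst (Matches Ps Π) (trans (sym (+-identityʳ m)) m+0≡H) match)
  alternation (suc h) m m+h≡H refl Ps Π match t (p , isP , t≗p) =
    t′ , witness-traces Ps′ i , alternation h (suc m) (trans (sym (+-suc m h)) m+h≡H) (sym (*-suc 2 m)) Ps′ Π′ match′
    where
    m<H : m < H
    m<H = subst (m <_) m+h≡H (m<m+n m z<s)
    i = fromℕ< m<H
    toℕ-i : toℕ i ≡ m
    toℕ-i = FinP.toℕ-fromℕ< m<H
    Ps′ = updateAt Ps i (const (p , isP))
    t′ = witness Ps′ i
    Π₁ = Π [ 2 * m ↦ t ]
    Π′ = Π₁ [ suc (2 * m) ↦ t′ ]

    unchanged : ∀ {π} → π < 2 * m → Π′ π ≡ Π π
    unchanged π<2m = trans ([↦]-miss Π₁ (suc (2 * m)) t′ (<⇒≢ (m<n⇒m<1+n π<2m))) ([↦]-miss Π (2 * m) t (<⇒≢ π<2m))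

    Ps′-below : ∀ k → toℕ k < m → Ps′ k ≡ Ps k
    Ps′-below k k<m = updateAt-minimal k i Ps (λ k≡i → <⇒≢ k<m (trans (cong toℕ k≡i) toℕ-i))

    Π′-at-2i : Π′ (2 * toℕ i) ≡ just t
    Π′-at-2i = trans (cong (λ k → Π′ (2 * k)) toℕ-i)
                     (trans ([↦]-miss Π₁ (suc (2 * m)) t′ (<⇒≢ (n<1+n (2 * m)))) ([↦]-hit Π (2 * m) t))

    Π′-at-2i+1 : Π′ (suc (2 * toℕ i)) ≡ just t′
    Π′-at-2i+1 = trans (cong (λ k → Π′ (suc (2 * k))) toℕ-i) ([↦]-hit Π₁ (suc (2 * m)) t′)

    new-match : Matched Ps′ Π′ i
    new-match =
      subst (λ mt → Pointwise _≗ᵗ_ mt (just (traceOf (Ps′ i)))) (sym Π′-at-2i)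
            (just λ r x → trans (t≗p r x) (cong (λ P → traceOf P r x) (sym (updateAt-updates i Ps))))
      , subst (λ mt → Pointwise _≗ᵗ_ mt (just t′)) (sym Π′-at-2i+1) (just λ _ _ → refl)

    old-match : ∀ j → toℕ j < m → Matched Ps′ Π′ j
    old-match j j<m =
      subst (λ mt → Pointwise _≗ᵗ_ mt (just (traceOf (Ps′ j)))) (sym (unchanged (m<n⇒2m<2n j<m)))
            (retarget old (λ r x → cong (λ P → traceOf P r x) (sym (Ps′-below j j<m))))
      , subst (λ mt → Pointwise _≗ᵗ_ mt (just (witness Ps′ j))) (sym (unchanged (m<n⇒1+2m<2n j<m)))
              (retarget old-witness (witness-agree j λ k k≤j → sym (Ps′-below k (≤-<-trans k≤j j<m))))
      where old = proj₁ (match j j<m)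
            old-witness = proj₂ (match j j<m)

    match′ : Matches Ps′ Π′ (suc m)
    match′ j (s≤s j≤m) =
      Sum.[ old-match j , (λ toℕ-j → subst (Matched Ps′ Π′) (i≡j toℕ-j) new-match) ]′ (m≤n⇒m<n∨m≡n j≤m)
      where i≡j : toℕ j ≡ m → i ≡ j
            i≡j toℕ-j = FinP.toℕ-injective (trans toℕ-i (sym toℕ-j))

  sound : T ⊨[ _≟ᵃ_ ] alt H 0 ψ
  sound = alternation H 0 refl refl (const somePath) Π∅ λ _ ()

mainTheorem1 : ExcludedMiddle 0ℓ →
    (a nV h' : ℕ) (T : TS (Fin a) (Fin nV)) (ψ : QF (Fin a)) →
    Closed ψ → TraceVarsIn (λ j → j < 2 * suc h') ψ →
    (n : Fin (suc h') → ℕ) (ξ : (i : Fin (suc h')) → Fin (n i) → QF (Fin a)) →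
    (∀ i ℓ → Closed (ξ i ℓ) ×
      TraceVarsIn (λ j → Σ ℕ (λ j' → j' ≤ toℕ i × j ≡ 2 * j')) (ξ i ℓ)) →
    (B : DPA (Vec (Letter (AP' a h' n)) (2 * suc h'))) →
    Game.Spec (decAP' a h' n) (manip n T) B (ψΞ ψ ξ) →
    Game.CoalitionWins (decAP' a h' n) (manip n T) B →
    T ⊨[ FinP._≟_ ] alt (suc h') 0 ψ
mainTheorem1 EM a nV h′ T ψ ψ-closed ψ-vars n ξ ξ-wf B spec (σ , σ-wins) =
  Soundness.sound EM T ψ ψ-closed ψ-vars n ξ ξ-wf B spec σ σ-wins
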